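{- Let $G$ be a graph on $n$ vertices, $\ell$ a positive integer, and $M\subseteq V(G)$ with $|M|=k$ such that $Q=G-M$ is a clique with $|V(Q)|>k$, and assume $n\le\ell+k$. Construct the bipartite graph $B$ and the matrix $A$ as follows. Let $C=\{c_1,\dots,c_\ell\}$, $C'=\{c'_v: v\in M\}$, and let $V'$ be a set of $\ell+k-n$ new (artificial) vertices. $B$ has bipartition $(V(G)\cup V',\,C\cup C')$, with edges: every $v\in V(G)$ is adjacent to all of $C$; each $v\in M$ is additionally adjacent to $c'_v$; every vertex of $V'$ is adjacent to all of $C\cup C'$. For each edge $(v,c)$ of $B$ define $\mathcal{S}_{(v,c)}\subseteq 2^M\times 2^M$: if $v\in V(Q)$ and $c\in C$, it consists of all pairs $(S_1,S_2)$ with $S_1\subseteq M$, $S_1\cup\{v\}$ independent in $G$, and $S_2=\{u\in M: N_G[u]\supseteq S_1\cup\{v\}\}$; if $v\in M$ and $c\in C$, it consists of all pairs $(S_1,S_2)$ with $S_1\subseteq M$ independent in $G$, $v\in S_1$, and $S_2=\{u\in M:N_G[u]\supseteq S_1\}$; if $v\in V'$ or $c\in C'$, then $\mathcal{S}_{(v,c)}=\{(\emptyset,\emptyset)\}$. With variables $x_u,y_u$ ($u\in M$) and $z_{(v,c)}$ (edges of $B$), let $P(v,c)=\sum_{(S_1,S_2)\in\mathcal{S}_{(v,c)}}\prod_{s\in S_1}x_s\prod_{s\in S_2}y_s$ (empty products equal $1$), and let $A$ be the square matrix with rows indexed by $V(G)\cup V'$ and columns by $C\cup C'$, with $A(v,c)=z_{(v,c)}P(v,c)$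 if $(v,c)\in E(B)$ and $A(v,c)=0$ otherwise. Then $G$ has a dominator coloring with at most $\ell$ colors if and only if the polynomial $\det A$ (over $\mathbb{R}$) contains a monomial divisible by $\prod_{u\in M}x_u y_u$.
   Context: Graphs are finite and simple; $N_G[v]=N_G(v)\cup\{v\}$. A proper coloring assigns different colors to adjacent vertices. A vertex $v$ dominates a set $T$ if $T\subseteq N_G[v]$. A dominator coloring of $G$ is a proper coloring in which every vertex dominates some color class. -}

module Defs where

open import Data.Nat as ℕ using (ℕ; zero; suc; _<?_)
open import Data.Fin using (Fin; zero; suc; toℕ; fromℕ<; splitAt; punchIn; _≟_)
open import Data.Fin.Properties using (all?)
open import Data.Integer as ℤ using (ℤ; +_; -_)
open import Data.List using (List; []; _∷_; [_]; _++_; map; concatMap; foldr; allFin)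
open import Data.Bool.ListAction using (any; all)
open import Data.Vec using (Vec; lookup) renaming ([] to []ᵥ; _∷_ to _∷ᵥ_)
open import Data.Bool using (Bool; true; false; if_then_else_; _∧_; _∨_; not)
open import Data.Product using (Σ; ∃; _×_; _,_)
open import Data.Sum using (_⊎_; inj₁; inj₂)
open import Data.Maybe using (Maybe; just; nothing)
open import Relation.Nullary using (Dec; yes; no; does; ¬_)
open import Relation.Nullary.Decidable using (_×-dec_)
open import Relation.Binary.PropositionalEquality using (_≡_; _≢_)

record Graph (n : ℕ) : Set where
  field
    adj    : Fin n → Fin n → Bool
    sym    : ∀ u v → adj u v ≡ adj v u
    irrefl : ∀ v → adj v v ≡ false
open Graph public

Adj : ∀ {n} → Graph n → Fin n → Fin n → Set
Adj G u v = adj G u v ≡ true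

InClosedNbhd : ∀ {n} → Graph n → Fin n → Fin n → Set
InClosedNbhd G v w = w ≡ v ⊎ Adj G v w

record DominatorColoring {n} (G : Graph n) (ℓ : ℕ) : Set where
  field
    col       : Fin n → Fin ℓ
    proper    : ∀ u v → Adj G u v → col u ≢ col v
    dominates : ∀ v → Σ (Fin ℓ) λ j →
                  (Σ (Fin n) λ w → col w ≡ j) ×
                  (∀ w → col w ≡ j → InClosedNbhd G v w)

-- A monomial is an exponent vector; a polynomial is a formal (unnormalised)
-- list of terms; its actual coefficient at a monomial is `coeff`.

record Mono (k N : ℕ) : Set where
  constructor mono
  field
    ex ey : Fin k → ℕ
    ez    : Fin N → Fin N → ℕ
open Mono public

_≟ₘ_ : ∀ {k N} (m m′ : Mono k N) →
       Dec ((∀ i → ex m i ≡ ex m′ i) × (∀ i → ey m i ≡ ey m′ i) ×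
            (∀ r c → ez m r c ≡ ez m′ r c))
m ≟ₘ m′ = all? (λ i → ex m i ℕ.≟ ex m′ i)
          ×-dec (all? (λ i → ey m i ℕ.≟ ey m′ i)
          ×-dec all? (λ r → all? (λ c → ez m r c ℕ.≟ ez m′ r c)))

mone : ∀ {k N} → Mono k N
mone = mono (λ _ → 0) (λ _ → 0) (λ _ _ → 0)

_·ₘ_ : ∀ {k N} → Mono k N → Mono k N → Mono k N
m ·ₘ m′ = mono (λ i → ex m i ℕ.+ ex m′ i) (λ i → ey m i ℕ.+ ey m′ i)
               (λ r c → ez m r c ℕ.+ ez m′ r c)

Poly : ℕ → ℕ → Set
Poly k N = List (ℤ × Mono k N)

coeff : ∀ {k N} → Poly k N → Mono k N → ℤ
coeff p m = foldr ℤ._+_ (+ 0)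
  (map (λ { (a , m′) → if does (m′ ≟ₘ m) then a else + 0 }) p)

pconst : ∀ {k N} → ℤ → Poly k N
pconst c = [ (c , mone) ]

_+ₚ_ : ∀ {k N} → Poly k N → Poly k N → Poly k N
p +ₚ q = p ++ q

_*ₚ_ : ∀ {k N} → Poly k N → Poly k N → Poly k N
p *ₚ q = concatMap (λ { (a , m) → map (λ { (b , m′) → (a ℤ.* b , m ·ₘ m′) }) q }) p

sumFin : ∀ {k N} s → (Fin s → Poly k N) → Poly k N
sumFin s f = foldr _+ₚ_ [] (map f (allFin s))

altSign : ℕ → ℤ
altSign zero    = + 1
altSign (suc j) = - altSign j

det : ∀ {k N} s → (Fin s → Fin s → Poly k N) → Poly k N
det zero    A = pconst (+ 1)
det (suc s) A = sumFin (suc s) λ j →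
  (pconst (altSign (toℕ j)) *ₚ A zero j) *ₚ det s (λ r c → A (suc r) (punchIn j c))

-- M is given by an injective enumeration m : Fin k → Fin n.
-- Rows of A: Fin (ℓ + k); row r with toℕ r < n is the vertex r of G, the other
-- ℓ + k - n rows are the artificial vertices V'.
-- Columns of A: Fin (ℓ + k); splitAt ℓ gives inj₁ j  ~ c_j ∈ C,
-- inj₂ i ~ c'_{m i} ∈ C'.
-- Variable x_i / y_i stands for x_{m i} / y_{m i}.

allSubsets : ∀ k → List (Vec Bool k)
allSubsets zero    = [ []ᵥ ]
allSubsets (suc k) = concatMap (λ S → (false ∷ᵥ S) ∷ (true ∷ᵥ S) ∷ []) (allSubsets k)

module Construction {n : ℕ} (G : Graph n) (ℓ k : ℕ) (m : Fin k → Fin n) where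

  N : ℕ
  N = ℓ ℕ.+ k

  inM : Fin n → Bool
  inM v = any (λ i → does (m i ≟ v)) (allFin k)

  memS : Vec Bool k → Fin n → Bool
  memS S w = any (λ i → lookup S i ∧ does (m i ≟ w)) (allFin k)

  independentB : (Fin n → Bool) → Bool
  independentB T = all (λ a → all (λ b → not (T a ∧ T b ∧ adj G a b)) (allFin n)) (allFin n)

  dominatorsB : (Fin n → Bool) → Fin k → Bool
  dominatorsB T i = all (λ w → not (T w) ∨ does (w ≟ m i) ∨ adj G (m i) w) (allFin n)

  term : Vec Bool k → (Fin n → Bool) → Poly k N
  term S1 T = [ (+ 1 , mono (λ i → if lookup S1 i then 1 else 0)
                            (λ i → if dominatorsB T i then 1 else 0)
                            (λ _ _ → 0)) ]

  P₁ : Fin n → Poly k N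
  P₁ v = foldr (λ S1 acc → let T = λ w → memS S1 w ∨ does (w ≟ v) in
                 if independentB T then term S1 T ++ acc else acc) [] (allSubsets k)

  P₂ : Fin n → Poly k N
  P₂ v = foldr (λ S1 acc → let T = memS S1 in
                 if independentB T ∧ memS S1 v then term S1 T ++ acc else acc) [] (allSubsets k)

  zvar : Fin N → Fin N → Poly k N
  zvar r c = [ (+ 1 , mono (λ _ → 0) (λ _ → 0)
                  (λ r′ c′ → if does (r′ ≟ r) ∧ does (c′ ≟ c) then 1 else 0)) ]

  rowVertex : Fin N → Maybe (Fin n)
  rowVertex r with toℕ r <? n
  ... | yes p = just (fromℕ< p)
  ... | no _  = nothing

  entry : Maybe (Fin n) → Fin ℓ ⊎ Fin k → Fin N → Fin N → Poly k N
  entry (just v) (inj₁ _) r c = zvar r c *ₚ (if inM v then P₂ v else P₁ v)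
  entry (just v) (inj₂ i) r c = if does (m i ≟ v) then zvar r c *ₚ pconst (+ 1) else []
  entry nothing  _        r c = zvar r c *ₚ pconst (+ 1)

  A : Fin N → Fin N → Poly k N
  A r c = entry (rowVertex r) (splitAt ℓ c) r c

  detA : Poly k N
  detA = det N A

-- A term of det A chooses, row by row, a column (a permutation) and a term of that entry;
-- the z-variables record the permutation, so terms with equal monomials have equal signs and
-- never cancel.  A dominator colouring yields such a choice containing every x_u and y_u: a
-- vertex of Q, and the least vertex of each colour class inside M, takes the column of its
-- colour with S₁ the part of its class in M; the other vertices of M take their own column
-- c′_v, and the rows of V′ fill the remaining columns.  Conversely, from such a term colour a
-- vertex by the colour column of its own row or, for v ∈ M sitting in c′_v, of the row whose
-- S₁ contains v.  Each S₁ ∪ {v} is independent and the y-variables give the domination of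
-- the vertices of M; as Q is a clique with more vertices than M, all of distinct colours, some
-- vertex of Q is alone in its colour class, and every vertex of Q dominates that class.

module Submission where

open import Defs hiding (sym)
open import Data.Nat as ℕ using (ℕ; zero; suc; _≤_; _<_; _+_; _∸_; z≤n; s≤s; _<?_)
import Data.Nat.Properties as ℕ
open import Data.Fin as Fin
  using (Fin; zero; suc; toℕ; punchIn; punchOut; _≟_; splitAt; _↑ˡ_; _↑ʳ_; fromℕ<; inject≤)
import Data.Fin.Properties as Fin
open import Data.Integer as ℤ using (ℤ; +_; ∣_∣)
import Data.Integer.Properties as ℤ
open import Data.List using (List; []; _∷_; _++_; foldr; allFin)
open import Data.List.Membership.Propositional using (_∈_; find; lose)
open import Data.List.Membership.Propositional.Properties
  using (∈-allFin; ∈-++⁺ˡ; ∈-++⁺ʳ; ∈-++⁻; ∈-map⁺; ∈-map⁻; ∈-concatMap⁺; ∈-concatMap⁻)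
open import Data.List.Relation.Unary.Any using (here; there)
import Data.List.Relation.Unary.All as All
open import Data.List.Relation.Unary.Any.Properties using (any⁺; any⁻)
open import Data.List.Relation.Unary.All.Properties using (all⁺; all⁻)
open import Data.Vec using (Vec; lookup; tabulate) renaming ([] to []ᵥ; _∷_ to _∷ᵥ_)
open import Data.Bool using (Bool; true; false; if_then_else_; _∧_; _∨_; not; T)
open import Data.Bool.Properties using (T-≡; T-irrelevant; not-¬; ¬-not; ∨-zeroʳ)
open import Data.Bool.ListAction using (any; all)
open import Data.Product using (Σ; ∃; ∃₂; _×_; _,_; proj₁; proj₂)
open import Data.Sum using (_⊎_; inj₁; inj₂)
open import Data.Maybe using (just; nothing; is-just; to-witness-T)
open import Data.Maybe.Properties using (just-injective)
open import Data.Sum.Properties using (inj₁-injective)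
open import Data.Unit using (tt)
open import Data.Vec.Properties using (lookup∘tabulate)
open import Data.Empty using (⊥-elim)
open import Function using (_∘_; Injective)
open import Function.Bundles using (Equivalence; _⇔_; mk⇔)
open import Relation.Nullary using (Dec; yes; no; does; ¬_; ¬?)
open import Relation.Nullary.Decidable using (dec-true; dec-false; T?; _×-dec_; _→-dec_; decidable-stable)
open import Relation.Binary.PropositionalEquality using (_≡_; _≢_; refl; sym; trans; cong; cong₂; subst)

does-true⇒ : ∀ {p} {P : Set p} (P? : Dec P) → does P? ≡ true → P
does-true⇒ (yes p) _ = p

module _ {n : ℕ} (p : Fin n → Bool) where

  any-allFin⁺ : ∀ i → p i ≡ true → any p (allFin n) ≡ true
  any-allFin⁺ i pi = Equivalence.to T-≡ (any⁺ p (lose (∈-allFin i) (Equivalence.from T-≡ pi)))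

  any-allFin⁻ : any p (allFin n) ≡ true → ∃ λ i → p i ≡ true
  any-allFin⁻ e with find (any⁻ p (allFin n) (Equivalence.from T-≡ e))
  ... | i , _ , pi = i , Equivalence.to T-≡ pi

  all-allFin⁺ : (∀ i → p i ≡ true) → all p (allFin n) ≡ true
  all-allFin⁺ h =
    Equivalence.to T-≡ (all⁻ p {xs = allFin n} (All.tabulate λ {i} _ → Equivalence.from T-≡ (h i)))

  all-allFin⁻ : all p (allFin n) ≡ true → ∀ i → p i ≡ true
  all-allFin⁻ e i = Equivalence.to T-≡ (All.lookup (all⁺ p (allFin n) (Equivalence.from T-≡ e)) (∈-allFin i))

∧-true⁻ : ∀ {a b} → a ∧ b ≡ true → a ≡ true × b ≡ true
∧-true⁻ {true} {true} _ = refl , refl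

∨-true⁻ : ∀ {a b} → a ∨ b ≡ true → a ≡ true ⊎ b ≡ true
∨-true⁻ {true}  _ = inj₁ refl
∨-true⁻ {false} b≡true = inj₂ b≡true

if-positive : ∀ b → 1 ≤ (if b then 1 else 0) → b ≡ true
if-positive true _ = refl

if-true : ∀ {b} → b ≡ true → 1 ≤ (if b then 1 else 0)
if-true refl = s≤s z≤n

positive-+ : ∀ a {b} → 1 ≤ a + b → 1 ≤ a ⊎ 1 ≤ b
positive-+ zero    pos = inj₂ pos
positive-+ (suc a) _   = inj₁ (s≤s z≤n)

k<n∸k⇒k+k<n : ∀ {k n} → k < n ∸ k → k + k < n
k<n∸k⇒k+k<n {k} {n} k<n∸k = ℕ.m≤o∸n⇒m+n≤o (suc k) k≤n k<n∸k
  where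
  k≤n : k ≤ n
  k≤n = ℕ.<⇒≤ (ℕ.m∸n≢0⇒n<m (ℕ.n>0⇒n≢0 (ℕ.≤-trans (s≤s z≤n) k<n∸k)))

module _ {A B : Set} (b : A → Bool) (f : A → List B) where

  ∈-foldr-if⁺ : ∀ {x y} xs → x ∈ xs → b x ≡ true → y ∈ f x →
                y ∈ foldr (λ x acc → if b x then f x ++ acc else acc) [] xs
  ∈-foldr-if⁺ (x ∷ xs) (here refl) bx y∈ rewrite bx = ∈-++⁺ˡ y∈
  ∈-foldr-if⁺ (x ∷ xs) (there x∈) bx y∈ with b x
  ... | true  = ∈-++⁺ʳ (f x) (∈-foldr-if⁺ xs x∈ bx y∈)
  ... | false = ∈-foldr-if⁺ xs x∈ bx y∈

  ∈-foldr-if⁻ : ∀ {y} xs → y ∈ foldr (λ x acc → if b x then f x ++ acc else acc) [] xs →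
                ∃ λ x → b x ≡ true × y ∈ f x
  ∈-foldr-if⁻ (x ∷ xs) y∈ with b x in bx
  ... | false = ∈-foldr-if⁻ xs y∈
  ... | true with ∈-++⁻ (f x) y∈
  ...   | inj₁ y∈fx = x , bx , y∈fx
  ...   | inj₂ y∈xs = ∈-foldr-if⁻ xs y∈xs

∈-allSubsets : ∀ {k} (S : Vec Bool k) → S ∈ allSubsets k
∈-allSubsets []ᵥ       = here refl
∈-allSubsets (b ∷ᵥ S) = ∈-concatMap⁺ _ (lose (∈-allSubsets S) (∈-pair b))
  where
  ∈-pair : ∀ b → b ∷ᵥ S ∈ (false ∷ᵥ S) ∷ (true ∷ᵥ S) ∷ []
  ∈-pair false = here refl
  ∈-pair true  = there (here refl)

↑ˡ≢↑ʳ : ∀ {a b} (i : Fin a) (j : Fin b) → i ↑ˡ b ≢ a ↑ʳ j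
↑ˡ≢↑ʳ {a} {b} i j eq
  with trans (sym (Fin.splitAt-↑ˡ a i b)) (trans (cong (splitAt a) eq) (Fin.splitAt-↑ʳ a b j))
... | ()

least : ∀ {s} {P : Fin s → Set} → (∀ i → Dec (P i)) → ∃ P → ∃ λ i → P i × (∀ j → P j → i Fin.≤ j)
least P? (zero , p₀) = zero , p₀ , λ _ _ → z≤n
least P? (suc i , pᵢ) with P? zero
... | yes p₀ = zero , p₀ , λ _ _ → z≤n
... | no ¬p₀ with least (P? ∘ suc) (i , pᵢ)
...   | i₀ , p , minimal = suc i₀ , p , λ { zero p′ → ⊥-elim (¬p₀ p′) ; (suc j) p′ → s≤s (minimal j p′) }

Outside : ∀ {n k} → (Fin k → Fin n) → Fin n → Set
Outside m u = ∀ i → m i ≢ u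

module _ {n k c : ℕ} (m : Fin k → Fin n) where

  -- Encode Fin n into Fin (k + k): image points by their index, outside points by the index
  -- of an image point of the same colour; injectivity contradicts k + k < n.
  unused-colour : (κ : Fin n → Fin c) → (∀ {u w} → Outside m u → Outside m w → κ u ≡ κ w → u ≡ w) →
                  k + k < n → ∃ λ q → Outside m q × (∀ i → κ (m i) ≢ κ q)
  unused-colour κ κ-injective k+k<n
    with Fin.any? (λ q → Fin.all? (λ i → ¬? (m i ≟ q)) ×-dec Fin.all? (λ i → ¬? (κ (m i) ≟ κ q)))
  ... | yes found = found
  ... | no none = ⊥-elim (collision (Fin.pigeonhole k+k<n λ u → code u (∈image? u)))
    where
    shares : ∀ u → Outside m u → ∃ λ i → κ (m i) ≡ κ u
    shares u out with Fin.¬∀⟶∃¬ k (λ i → κ (m i) ≢ κ u) (λ i → ¬? (κ (m i) ≟ κ u))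
                                  (λ unused → none (u , out , unused))
    ... | i , ¬≢ = i , decidable-stable (κ (m i) ≟ κ u) ¬≢
    outside : ∀ {u} → ¬ (∃ λ i → m i ≡ u) → Outside m u
    outside ∉m i mi≡u = ∉m (i , mi≡u)
    code : ∀ u → Dec (∃ λ i → m i ≡ u) → Fin (k + k)
    code u (yes (i , _)) = i ↑ˡ k
    code u (no ∉m)       = k ↑ʳ proj₁ (shares u (outside ∉m))
    code-injective : ∀ u w u? w? → code u u? ≡ code w w? → u ≡ w
    code-injective u w (yes (i , refl)) (yes (j , refl)) eq = cong m (Fin.↑ˡ-injective k i j eq)
    code-injective u w (yes _) (no _) eq = ⊥-elim (↑ˡ≢↑ʳ _ _ eq)
    code-injective u w (no _) (yes _) eq = ⊥-elim (↑ˡ≢↑ʳ _ _ (sym eq))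
    code-injective u w (no ∉m) (no ∉m′) eq = κ-injective (outside ∉m) (outside ∉m′)
      (trans (sym (proj₂ (shares u (outside ∉m))))
        (trans (cong (κ ∘ m) (Fin.↑ʳ-injective k _ _ eq)) (proj₂ (shares w (outside ∉m′)))))
    ∈image? : ∀ u → Dec (∃ λ i → m i ≡ u)
    ∈image? u = Fin.any? (λ i → m i ≟ u)
    collision : ¬ ∃₂ λ u w → u Fin.< w × code u (∈image? u) ≡ code w (∈image? w)
    collision (u , w , u<w , same) = ℕ.<⇒≢ u<w (cong toℕ (code-injective u w (∈image? u) (∈image? w) same))

Term : ℕ → ℕ → Set
Term k N = ℤ × Mono k N

Matrix : ℕ → ℕ → ℕ → Set
Matrix k N s = Fin s → Fin s → Poly k N

module _ {N : ℕ} where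

  zIndicator : Fin N → Fin N → Fin N → Fin N → ℕ
  zIndicator r c R C = if does (R ≟ r) ∧ does (C ≟ c) then 1 else 0

  zIndicator-refl : ∀ r c → zIndicator r c r c ≡ 1
  zIndicator-refl r c rewrite dec-true (r ≟ r) refl | dec-true (c ≟ c) refl = refl

  zIndicator-otherRow : ∀ {r R} c C → R ≢ r → zIndicator r c R C ≡ 0
  zIndicator-otherRow {r} {R} c C R≢r rewrite dec-false (R ≟ r) R≢r = refl

  zIndicator≡1⇒ : ∀ r c R C → zIndicator r c R C ≡ 1 → C ≡ c
  zIndicator≡1⇒ r c R C eq with R ≟ r | C ≟ c
  ... | yes _ | yes C≡c = C≡c
  ... | yes _ | no  _   = ⊥-elim (ℕ.0≢1+n eq)
  ... | no  _ | _       = ⊥-elim (ℕ.0≢1+n eq)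

module _ {k N : ℕ} where

  _*ₜ_ : Term k N → Term k N → Term k N
  (a , μ) *ₜ (b , ν) = a ℤ.* b , μ ·ₘ ν

  ∈-*ₚ⁺ : ∀ {p q : Poly k N} {t u} → t ∈ p → u ∈ q → t *ₜ u ∈ p *ₚ q
  ∈-*ₚ⁺ t∈p u∈q = ∈-concatMap⁺ _ (lose t∈p (∈-map⁺ _ u∈q))

  ∈-*ₚ⁻ : ∀ (p q : Poly k N) {v} → v ∈ p *ₚ q → ∃₂ λ t u → t ∈ p × u ∈ q × v ≡ t *ₜ u
  ∈-*ₚ⁻ p q v∈ with find (∈-concatMap⁻ _ {xs = p} v∈)
  ... | t , t∈p , v∈tq with ∈-map⁻ _ v∈tq
  ... | u , u∈q , refl = t , u , t∈p , u∈q , refl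

  ∈-sumFin⁺ : ∀ s (f : Fin s → Poly k N) j {t} → t ∈ f j → t ∈ sumFin s f
  ∈-sumFin⁺ s f j t∈ = ∈-concatMap⁺ f (lose (∈-allFin j) t∈)

  ∈-sumFin⁻ : ∀ s (f : Fin s → Poly k N) {t} → t ∈ sumFin s f → ∃ λ j → t ∈ f j
  ∈-sumFin⁻ s f t∈ with find (∈-concatMap⁻ f {xs = allFin s} t∈)
  ... | j , _ , t∈fj = j , t∈fj

  minor : ∀ {s} → Matrix k N (suc s) → Fin (suc s) → Matrix k N s
  minor A j r c = A (suc r) (punchIn j c)

  cofactorTerm : ∀ {s} → Fin (suc s) → Term k N → Term k N → Term k N
  cofactorTerm j e d = ((altSign (toℕ j) , mone) *ₜ e) *ₜ d

  ∈-det-suc⁺ : ∀ {s} (A : Matrix k N (suc s)) j {e d} →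
               e ∈ A zero j → d ∈ det s (minor A j) → cofactorTerm j e d ∈ det (suc s) A
  ∈-det-suc⁺ A j {e} {d} e∈ d∈ =
    ∈-sumFin⁺ _ _ j (∈-*ₚ⁺ {t = σⱼ *ₜ e} {u = d} (∈-*ₚ⁺ {p = pconst (proj₁ σⱼ)} {t = σⱼ} (here refl) e∈) d∈)
    where
    σⱼ : Term k N
    σⱼ = altSign (toℕ j) , mone

  ∈-det-suc⁻ : ∀ {s} (A : Matrix k N (suc s)) {t} → t ∈ det (suc s) A →
               ∃ λ j → ∃₂ λ e d → e ∈ A zero j × d ∈ det s (minor A j) × t ≡ cofactorTerm j e d
  ∈-det-suc⁻ {s} A t∈ with ∈-sumFin⁻ (suc s) _ t∈
  ... | j , t∈ⱼ with ∈-*ₚ⁻ (pconst (altSign (toℕ j)) *ₚ A zero j) (det s (minor A j)) t∈ⱼ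
  ... | u , d , u∈ , d∈ , refl with ∈-*ₚ⁻ (pconst (altSign (toℕ j))) (A zero j) u∈
  ... | _ , e , here refl , e∈ , refl = j , e , d , e∈ , d∈ , refl

  IsAdditive : (Mono k N → Fin k → ℕ) → Set
  IsAdditive f = (∀ i → f mone i ≡ 0) × (∀ μ ν i → f (μ ·ₘ ν) i ≡ f μ i + f ν i)

  ex-additive : IsAdditive ex
  ex-additive = (λ _ → refl) , (λ _ _ _ → refl)

  ey-additive : IsAdditive ey
  ey-additive = (λ _ → refl) , (λ _ _ _ → refl)

  cofactorTerm-exponent : ∀ f → IsAdditive f → ∀ {s} (j : Fin (suc s)) e d i →
                          f (proj₂ (cofactorTerm j e d)) i ≡ f (proj₂ e) i + f (proj₂ d) i
  cofactorTerm-exponent f (f-mone , f-·ₘ) j e d i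
    rewrite f-·ₘ (mone ·ₘ proj₂ e) (proj₂ d) i | f-·ₘ mone (proj₂ e) i | f-mone i = refl

  record Transversal {s} (A : Matrix k N s) : Set where
    field
      column           : Fin s → Fin s
      column-injective : Injective _≡_ _≡_ column
      choice           : Fin s → Term k N
      choice∈          : ∀ r → choice r ∈ A r (column r)

  ∈-det⁻ : ∀ s (A : Matrix k N s) {t} → t ∈ det s A → Σ (Transversal A) λ T →
           ∀ f → IsAdditive f → ∀ i → 1 ≤ f (proj₂ t) i →
           ∃ λ r → 1 ≤ f (proj₂ (Transversal.choice T r)) i
  ∈-det⁻ zero A (here refl) =
    record { column = λ () ; column-injective = λ { {()} } ; choice = λ () ; choice∈ = λ () } ,
    λ _ (f-mone , _) i pos → ⊥-elim (ℕ.<⇒≢ pos (sym (f-mone i)))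
  ∈-det⁻ (suc s) A t∈ with ∈-det-suc⁻ A t∈
  ... | j , e , d , e∈ , d∈ , refl with ∈-det⁻ s (minor A j) d∈
  ... | T , covered = record
        { column = column′ ; column-injective = column′-injective
        ; choice = choice′ ; choice∈ = choice′∈ } , covered′
    where
    open Transversal T
    column′ : Fin (suc s) → Fin (suc s)
    column′ zero    = j
    column′ (suc r) = punchIn j (column r)
    column′-injective : Injective _≡_ _≡_ column′
    column′-injective {zero}  {zero}   _  = refl
    column′-injective {zero}  {suc r′} eq = ⊥-elim (Fin.punchInᵢ≢i j (column r′) (sym eq))
    column′-injective {suc r} {zero}   eq = ⊥-elim (Fin.punchInᵢ≢i j (column r) eq)
    column′-injective {suc r} {suc r′} eq =
      cong suc (column-injective (Fin.punchIn-injective j _ _ eq))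
    choice′ : Fin (suc s) → Term k N
    choice′ zero    = e
    choice′ (suc r) = choice r
    choice′∈ : ∀ r → choice′ r ∈ A r (column′ r)
    choice′∈ zero    = e∈
    choice′∈ (suc r) = choice∈ r
    covered′ : ∀ f → IsAdditive f → ∀ i → 1 ≤ f (proj₂ (cofactorTerm j e d)) i →
               ∃ λ r → 1 ≤ f (proj₂ (choice′ r)) i
    covered′ f f+ i pos with positive-+ _ (subst (1 ≤_) (cofactorTerm-exponent f f+ j e d i) pos)
    ... | inj₁ pos-e = zero , pos-e
    ... | inj₂ pos-d with covered f f+ i pos-d
    ... | r , pos-r = suc r , pos-r

  record PartialTransversal {s} (A : Matrix k N s) (fixed : Fin s → Bool) : Set where
    field
      column           : ∀ r → T (fixed r) → Fin s
      column-injective : ∀ {r r′} fr fr′ → column r fr ≡ column r′ fr′ → r ≡ r′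
      choice           : ∀ r → T (fixed r) → Term k N
      choice∈          : ∀ r fr → choice r fr ∈ A r (column r fr)

  emptyTransversal : ∀ {s} (A : Matrix k N s) → PartialTransversal A (λ _ → false)
  emptyTransversal A = record
    { column = λ _ () ; column-injective = λ () ; choice = λ _ () ; choice∈ = λ _ () }

  BoundsChoices : ∀ {s} {A : Matrix k N s} {fixed} → PartialTransversal A fixed → Term k N → Set
  BoundsChoices P t = ∀ f → IsAdditive f → ∀ r fr i →
                      f (proj₂ (PartialTransversal.choice P r fr)) i ≤ f (proj₂ t) i

  ∈-det⁺ : ∀ s (A : Matrix k N s) {fixed : Fin s → Bool} →
           (∀ {r r′} → toℕ r ≤ toℕ r′ → T (fixed r′) → T (fixed r)) →
           (∀ r c → ¬ T (fixed r) → ∃ λ t → t ∈ A r c) →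
           (P : PartialTransversal A fixed) → ∃ λ t → t ∈ det s A × BoundsChoices P t
  ∈-det⁺ zero A _ _ _ = (+ 1 , mone) , here refl , λ _ _ ()
  ∈-det⁺ (suc s) A {fixed} fixed-downward free-full P with T? (fixed zero)
  ... | yes fixed₀ =
    let d , d∈ , bounds-d = ∈-det⁺ s (minor A j) (fixed-downward ∘ s≤s)
                               (λ r c → free-full (suc r) (punchIn j c)) P′
    in cofactorTerm j e d , ∈-det-suc⁺ A j (choice∈ zero fixed₀) d∈ , bounds d bounds-d
    where
    open PartialTransversal P
    j : Fin (suc s)
    j = column zero fixed₀
    e : Term k N
    e = choice zero fixed₀
    j≢ : ∀ r fr → j ≢ column (suc r) fr
    j≢ r fr eq = Fin.0≢1+n (column-injective fixed₀ fr eq)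
    P′ : PartialTransversal (minor A j) (fixed ∘ suc)
    P′ = record
      { column           = λ r fr → punchOut (j≢ r fr)
      ; column-injective = λ fr fr′ eq → Fin.suc-injective
          (column-injective fr fr′ (Fin.punchOut-injective (j≢ _ fr) (j≢ _ fr′) eq))
      ; choice           = λ r → choice (suc r)
      ; choice∈          = λ r fr → subst (choice (suc r) fr ∈_)
          (cong (A (suc r)) (sym (Fin.punchIn-punchOut (j≢ r fr)))) (choice∈ (suc r) fr)
      }
    bounds : ∀ d → BoundsChoices P′ d → BoundsChoices P (cofactorTerm j e d)
    bounds d bounds-d f f+ r fr i rewrite cofactorTerm-exponent f f+ j e d i with r
    ... | zero  = subst (λ fr → f (proj₂ (choice zero fr)) i ≤ _) (T-irrelevant fixed₀ fr) (ℕ.m≤m+n _ _)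
    ... | suc r = ℕ.≤-trans (bounds-d f f+ r fr i) (ℕ.m≤n+m _ _)
  ... | no free₀ =
    let e , e∈ = free-full zero zero free₀
        d , d∈ , _ = ∈-det⁺ s (minor A zero) (λ _ ())
                       (λ r c _ → free-full (suc r) (punchIn zero c) (free-row (suc r)))
                       (emptyTransversal (minor A zero))
    in cofactorTerm {s} zero e d , ∈-det-suc⁺ A zero e∈ d∈ , λ _ _ r fr _ → ⊥-elim (free-row r fr)
    where
    free-row : ∀ r → ¬ T (fixed r)
    free-row r = free₀ ∘ fixed-downward {r′ = r} z≤n

  -- Every term of A r c has coefficient 1 and, among the z-variables, exactly z_(ρ r , γ c);
  -- ρ and γ record where a minor sits inside the original matrix.
  Tagged : ∀ {s} → Matrix k N s → (Fin s → Fin N) → (Fin s → Fin N) → Set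
  Tagged A ρ γ = ∀ r c t → t ∈ A r c →
                 proj₁ t ≡ + 1 × (∀ R C → ez (proj₂ t) R C ≡ zIndicator (ρ r) (γ c) R C)

  Tagged-minor : ∀ {s} {A : Matrix k N (suc s)} {ρ γ} → Tagged A ρ γ →
                 ∀ j → Tagged (minor A j) (ρ ∘ suc) (γ ∘ punchIn j)
  Tagged-minor tagged j r c = tagged (suc r) (punchIn j c)

  ∣altSign∣≡1 : ∀ j → ∣ altSign j ∣ ≡ 1
  ∣altSign∣≡1 zero    = refl
  ∣altSign∣≡1 (suc j) = trans (ℤ.∣-i∣≡∣i∣ (altSign j)) (∣altSign∣≡1 j)

  det-coeff-unit : ∀ {s} {A : Matrix k N s} {ρ γ} → Tagged A ρ γ →
                   ∀ {t} → t ∈ det s A → ∣ proj₁ t ∣ ≡ 1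
  det-coeff-unit {zero}          _      (here refl) = refl
  det-coeff-unit {suc s} {A} tagged t∈ with ∈-det-suc⁻ A t∈
  ... | j , e , d , e∈ , d∈ , refl
    rewrite ℤ.abs-* (altSign (toℕ j) ℤ.* proj₁ e) (proj₁ d) | ℤ.abs-* (altSign (toℕ j)) (proj₁ e)
          | ∣altSign∣≡1 (toℕ j) | proj₁ (tagged zero j e e∈)
          | det-coeff-unit (Tagged-minor tagged j) d∈ = refl

  det-ez-otherRow : ∀ {s} {A : Matrix k N s} {ρ γ} → Tagged A ρ γ →
                    ∀ {t} → t ∈ det s A → ∀ R → (∀ r → ρ r ≢ R) → ∀ C → ez (proj₂ t) R C ≡ 0
  det-ez-otherRow {zero}      _      (here refl) R R∉ρ C = refl
  det-ez-otherRow {suc s} {A} {ρ} {γ} tagged t∈ R R∉ρ C with ∈-det-suc⁻ A t∈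
  ... | j , e , d , e∈ , d∈ , refl
    rewrite proj₂ (tagged zero j e e∈) R C | zIndicator-otherRow (γ j) C (R∉ρ zero ∘ sym)
    = det-ez-otherRow (Tagged-minor tagged j) d∈ R (R∉ρ ∘ suc) C

  -- The z-part of a term of the determinant records its permutation (row ρ 0 carries z only
  -- in column γ j), hence its sign.
  det-coeff-determined : ∀ {s} {A : Matrix k N s} {ρ γ} → Tagged A ρ γ →
                         Injective _≡_ _≡_ ρ → Injective _≡_ _≡_ γ →
                         ∀ {t t′} → t ∈ det s A → t′ ∈ det s A →
                         (∀ R C → ez (proj₂ t) R C ≡ ez (proj₂ t′) R C) → proj₁ t ≡ proj₁ t′
  det-coeff-determined {zero} _ _ _ (here refl) (here refl) _ = refl
  det-coeff-determined {suc s} {A} {ρ} {γ} tagged ρ-inj γ-inj t∈ t′∈ same-z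
    with ∈-det-suc⁻ A t∈ | ∈-det-suc⁻ A t′∈
  ... | j , e , d , e∈ , d∈ , refl | j′ , e′ , d′ , e′∈ , d′∈ , refl
    with γ-inj (zIndicator≡1⇒ (ρ zero) (γ j′) (ρ zero) (γ j)
           (trans (sym (row₀ e′∈ d′∈ (γ j)))
             (trans (sym (same-z (ρ zero) (γ j)))
               (trans (row₀ e∈ d∈ (γ j)) (zIndicator-refl (ρ zero) (γ j))))))
    where
    row₀ : ∀ {j e d} → e ∈ A zero j → d ∈ det s (minor A j) → ∀ C →
           ez (proj₂ (cofactorTerm j e d)) (ρ zero) C ≡ zIndicator (ρ zero) (γ j) (ρ zero) C
    row₀ {j} {e} e∈ d∈ C
      rewrite proj₂ (tagged zero j e e∈) (ρ zero) C
            | det-ez-otherRow (Tagged-minor tagged j) d∈ (ρ zero) (λ r eq → Fin.0≢1+n (ρ-inj (sym eq))) C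
      = ℕ.+-identityʳ _
  ... | refl = cong₂ (λ a b → (altSign (toℕ j) ℤ.* a) ℤ.* b)
                 (trans (proj₁ (tagged zero j e e∈)) (sym (proj₁ (tagged zero j e′ e′∈))))
                 (det-coeff-determined (Tagged-minor tagged j) (Fin.suc-injective ∘ ρ-inj)
                    (Fin.punchIn-injective j _ _ ∘ γ-inj) d∈ d′∈ same-minor-z)
    where
    same-minor-z : ∀ R C → ez (proj₂ d) R C ≡ ez (proj₂ d′) R C
    same-minor-z R C = ℕ.+-cancelˡ-≡ (ez (proj₂ e) R C) _ _ (trans (same-z R C)
      (cong (_+ ez (proj₂ d′) R C)
        (trans (proj₂ (tagged zero j e′ e′∈) R C) (sym (proj₂ (tagged zero j e e∈) R C)))))

  Matches : Mono k N → Term k N → Set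
  Matches μ t = does (proj₂ t ≟ₘ μ) ≡ true

  coeff≢0⇒∃term : ∀ p μ → coeff p μ ≢ + 0 → ∃ λ t → t ∈ p × Matches μ t
  coeff≢0⇒∃term []            μ coeff≢0 = ⊥-elim (coeff≢0 refl)
  coeff≢0⇒∃term ((a , ν) ∷ p) μ coeff≢0 with does (ν ≟ₘ μ) in match
  ... | true  = (a , ν) , here refl , match
  ... | false with coeff≢0⇒∃term p μ (coeff≢0 ∘ trans (ℤ.+-identityˡ _))
  ... | t , t∈ , t-match = t , there t∈ , t-match

  coeff-uniform : ∀ p μ c → (∀ t → t ∈ p → Matches μ t → proj₁ t ≡ c) →
                  ∃ λ n → coeff p μ ≡ c ℤ.* + n × (∀ t → t ∈ p → Matches μ t → 1 ≤ n)
  coeff-uniform []            μ c _       = 0 , sym (ℤ.*-zeroʳ c) , λ _ ()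
  coeff-uniform ((a , ν) ∷ p) μ c uniform with coeff-uniform p μ c (λ t → uniform t ∘ there)
  ... | n , coeff≡ , n-pos with does (ν ≟ₘ μ) in match
  ... | true  = suc n ,
        trans (cong₂ ℤ._+_ (trans (uniform _ (here refl) match) (sym (ℤ.*-identityʳ c))) coeff≡)
              (sym (ℤ.*-distribˡ-+ c (+ 1) (+ n))) ,
        λ _ _ _ → s≤s z≤n
  ... | false = n , trans (ℤ.+-identityˡ _) coeff≡ ,
        λ { t (here refl) t-match → ⊥-elim (not-¬ match t-match)
          ; t (there t∈) t-match → n-pos t t∈ t-match }

  ∣c∣≡1⇒c*n≢0 : ∀ c n → ∣ c ∣ ≡ 1 → 1 ≤ n → c ℤ.* + n ≢ + 0
  ∣c∣≡1⇒c*n≢0 c n ∣c∣≡1 n-pos c*n≡0 = ℕ.<⇒≢ n-pos (sym n≡0)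
    where
    n≡0 : n ≡ 0
    n≡0 = trans (sym (ℕ.*-identityˡ n))
            (trans (cong (ℕ._* n) (sym ∣c∣≡1)) (trans (sym (ℤ.abs-* c (+ n))) (cong ∣_∣ c*n≡0)))

  coeff-det≢0 : ∀ {s} {A : Matrix k N s} {ρ γ} → Tagged A ρ γ →
                Injective _≡_ _≡_ ρ → Injective _≡_ _≡_ γ →
                ∀ {t} → t ∈ det s A → coeff (det s A) (proj₂ t) ≢ + 0
  coeff-det≢0 {s} {A} tagged ρ-inj γ-inj {t} t∈ coeff≡0
    with coeff-uniform (det s A) (proj₂ t) (proj₁ t) same-coeff
    where
    same-coeff : ∀ t′ → t′ ∈ det s A → Matches (proj₂ t) t′ → proj₁ t′ ≡ proj₁ t
    same-coeff t′ t′∈ match = det-coeff-determined tagged ρ-inj γ-inj t′∈ t∈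
      (proj₂ (proj₂ (does-true⇒ (proj₂ t′ ≟ₘ proj₂ t) match)))
  ... | n , coeff≡ , n-pos =
    ∣c∣≡1⇒c*n≢0 (proj₁ t) n (det-coeff-unit tagged t∈)
      (n-pos t t∈ (dec-true (proj₂ t ≟ₘ proj₂ t) ((λ _ → refl) , (λ _ → refl) , (λ _ _ → refl))))
      (trans (sym coeff≡) coeff≡0)

module Reduction {n : ℕ} (G : Graph n) (ℓ k : ℕ) (m : Fin k → Fin n) where
  open Construction G ℓ k m

  inM-true⁻ : ∀ {v} → inM v ≡ true → ∃ λ i → m i ≡ v
  inM-true⁻ {v} v∈M with any-allFin⁻ _ v∈M
  ... | i , mi≟v = i , does-true⇒ (m i ≟ v) mi≟v

  inM-true⁺ : ∀ {i v} → m i ≡ v → inM v ≡ true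
  inM-true⁺ {i} {v} mi≡v = any-allFin⁺ _ i (dec-true (m i ≟ v) mi≡v)

  inM-false : ∀ {v} → Outside m v → inM v ≡ false
  inM-false out = ¬-not λ v∈M → let i , mi≡v = inM-true⁻ v∈M in out i mi≡v

  memS-true⁺ : ∀ S i → lookup S i ≡ true → memS S (m i) ≡ true
  memS-true⁺ S i Sᵢ = any-allFin⁺ _ i
    (subst (λ b → b ∧ does (m i ≟ m i) ≡ true) (sym Sᵢ) (dec-true (m i ≟ m i) refl))

  memS-true⁻ : ∀ S w → memS S w ≡ true → ∃ λ i → lookup S i ≡ true × m i ≡ w
  memS-true⁻ S w w∈S with any-allFin⁻ _ w∈S
  ... | i , Sᵢ∧mi≟w = i , proj₁ (∧-true⁻ Sᵢ∧mi≟w) , does-true⇒ (m i ≟ w) (proj₂ (∧-true⁻ Sᵢ∧mi≟w))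

  Independent : (Fin n → Bool) → Set
  Independent X = ∀ a b → X a ≡ true → X b ≡ true → ¬ Adj G a b

  independentB-true⁺ : ∀ X → Independent X → independentB X ≡ true
  independentB-true⁺ X independent = all-allFin⁺ _ λ a → all-allFin⁺ _ λ b → non-edge a b
    where
    non-edge : ∀ a b → not (X a ∧ X b ∧ adj G a b) ≡ true
    non-edge a b with X a in Xa | X b in Xb | adj G a b in a~b
    ... | true  | true  | true  = ⊥-elim (independent a b Xa Xb a~b)
    ... | true  | true  | false = refl
    ... | true  | false | _     = refl
    ... | false | _     | _     = refl

  independentB-true⁻ : ∀ X → independentB X ≡ true → Independent X
  independentB-true⁻ X indep a b Xa Xb a~b
    with all-allFin⁻ _ (all-allFin⁻ _ indep a) b
  ... | non-edge rewrite Xa | Xb | a~b with non-edge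
  ... | ()

  DominatedBy : Fin n → (Fin n → Bool) → Set
  DominatedBy v X = ∀ w → X w ≡ true → InClosedNbhd G v w

  dominatorsB-true⁺ : ∀ X i → DominatedBy (m i) X → dominatorsB X i ≡ true
  dominatorsB-true⁺ X i dominated = all-allFin⁺ _ dominates
    where
    dominates : ∀ w → not (X w) ∨ does (w ≟ m i) ∨ adj G (m i) w ≡ true
    dominates w with X w in Xw
    ... | false = refl
    ... | true with dominated w Xw
    ...   | inj₁ w≡mi rewrite dec-true (w ≟ m i) w≡mi = refl
    ...   | inj₂ mi~w rewrite mi~w = ∨-zeroʳ _

  dominatorsB-true⁻ : ∀ X i → dominatorsB X i ≡ true → DominatedBy (m i) X
  dominatorsB-true⁻ X i dom w Xw with all-allFin⁻ _ dom w
  ... | dominates rewrite Xw with ∨-true⁻ dominates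
  ...   | inj₁ w≟mi = inj₁ (does-true⇒ (w ≟ m i) w≟mi)
  ...   | inj₂ mi~w = inj₂ mi~w

  termMono : Vec Bool k → (Fin n → Bool) → Mono k N
  termMono S X = mono (λ i → if lookup S i then 1 else 0)
                      (λ i → if dominatorsB X i then 1 else 0) (λ _ _ → 0)

  withVertex : Vec Bool k → Fin n → Fin n → Bool
  withVertex S v w = memS S w ∨ does (w ≟ v)

  private
    P₁-guard : Fin n → Vec Bool k → Bool
    P₁-guard v S = independentB (withVertex S v)
    P₁-term : Fin n → Vec Bool k → Poly k N
    P₁-term v S = term S (withVertex S v)
    P₂-guard : Fin n → Vec Bool k → Bool
    P₂-guard v S = independentB (memS S) ∧ memS S v
    P₂-term : Vec Bool k → Poly k N
    P₂-term S = term S (memS S)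

  ∈-P₁⁺ : ∀ S v → independentB (withVertex S v) ≡ true → (+ 1 , termMono S (withVertex S v)) ∈ P₁ v
  ∈-P₁⁺ S v indep = ∈-foldr-if⁺ (P₁-guard v) (P₁-term v) (allSubsets k) (∈-allSubsets S) indep (here refl)

  ∈-P₁⁻ : ∀ v {t} → t ∈ P₁ v →
          ∃ λ S → independentB (withVertex S v) ≡ true × t ≡ (+ 1 , termMono S (withVertex S v))
  ∈-P₁⁻ v t∈ with ∈-foldr-if⁻ (P₁-guard v) (P₁-term v) (allSubsets k) t∈
  ... | S , indep , here refl = S , indep , refl

  ∈-P₂⁺ : ∀ S v → independentB (memS S) ≡ true → memS S v ≡ true → (+ 1 , termMono S (memS S)) ∈ P₂ v
  ∈-P₂⁺ S v indep v∈S =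
    ∈-foldr-if⁺ (P₂-guard v) P₂-term (allSubsets k) (∈-allSubsets S) (cong₂ _∧_ indep v∈S) (here refl)

  ∈-P₂⁻ : ∀ v {t} → t ∈ P₂ v →
          ∃ λ S → independentB (memS S) ≡ true × memS S v ≡ true × t ≡ (+ 1 , termMono S (memS S))
  ∈-P₂⁻ v t∈ with ∈-foldr-if⁻ (P₂-guard v) P₂-term (allSubsets k) t∈
  ... | S , indep∧v∈S , here refl = S , proj₁ (∧-true⁻ indep∧v∈S) , proj₂ (∧-true⁻ indep∧v∈S) , refl

  P : Fin n → Poly k N
  P v = if inM v then P₂ v else P₁ v

  -- What a term of P(v , c) with pair (S₁ , S₂) certifies: set = S₁ ∪ {v} is independent,
  -- x_i occurs only for m i ∈ S₁ and y_i only for m i ∈ S₂.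
  record Support (v : Fin n) (μ : Mono k N) : Set where
    field
      set         : Fin n → Bool
      independent : Independent set
      ∋v          : set v ≡ true
      ∋x          : ∀ i → 1 ≤ ex μ i → set (m i) ≡ true
      dominated   : ∀ i → 1 ≤ ey μ i → DominatedBy (m i) set

  termMono-support : ∀ S X v → independentB X ≡ true → X v ≡ true →
                     (∀ i → lookup S i ≡ true → X (m i) ≡ true) → Support v (termMono S X)
  termMono-support S X v indep Xv S⊆X = record
    { set         = X
    ; independent = independentB-true⁻ X indep
    ; ∋v          = Xv
    ; ∋x          = λ i pos → S⊆X i (if-positive _ pos)
    ; dominated   = λ i pos → dominatorsB-true⁻ X i (if-positive _ pos)
    }

  ∈-P-support : ∀ v {t} → t ∈ P v → Support v (proj₂ t)
  ∈-P-support v t∈ with inM v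
  ... | true with ∈-P₂⁻ v t∈
  ...   | S , indep , v∈S , refl = termMono-support S (memS S) v indep v∈S (memS-true⁺ S)
  ∈-P-support v t∈ | false with ∈-P₁⁻ v t∈
  ...   | S , indep , refl = termMono-support S (withVertex S v) v indep
            (trans (cong (memS S v ∨_) (dec-true (v ≟ v) refl)) (∨-zeroʳ _))
            (λ i Sᵢ → cong (_∨ does (m i ≟ v)) (memS-true⁺ S i Sᵢ))

  ∈-P-z-free : ∀ v {t} → t ∈ P v → proj₁ t ≡ + 1 × (∀ R C → ez (proj₂ t) R C ≡ 0)
  ∈-P-z-free v t∈ with inM v
  ... | true with ∈-P₂⁻ v t∈
  ...   | _ , _ , _ , refl = refl , λ _ _ → refl
  ∈-P-z-free v t∈ | false with ∈-P₁⁻ v t∈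
  ...   | _ , _ , refl = refl , λ _ _ → refl

  zTerm : Fin N → Fin N → Term k N
  zTerm r c = + 1 , mono (λ _ → 0) (λ _ → 0) (zIndicator r c)

  ∈-zvar*⁺ : ∀ {r c u q} → u ∈ q → zTerm r c *ₜ u ∈ zvar r c *ₚ q
  ∈-zvar*⁺ {r} {c} = ∈-*ₚ⁺ {p = zvar r c} (here refl)

  XYFree : Mono k N → Set
  XYFree μ = ∀ i → ex μ i ≡ 0 × ey μ i ≡ 0

  ∈-zvar*1⁻ : ∀ {r c t} → t ∈ zvar r c *ₚ pconst (+ 1) →
              proj₁ t ≡ + 1 × XYFree (proj₂ t) × (∀ R C → ez (proj₂ t) R C ≡ zIndicator r c R C)
  ∈-zvar*1⁻ {r} {c} t∈ with ∈-*ₚ⁻ (zvar r c) (pconst (+ 1)) t∈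
  ... | _ , _ , here refl , here refl , refl = refl , (λ _ → refl , refl) , λ _ _ → ℕ.+-identityʳ _

  A-tagged : Tagged A (λ r → r) (λ c → c)
  A-tagged r c t t∈ = tagged (rowVertex r) (splitAt ℓ c) t∈
    where
    tagged : ∀ mv sc {t} → t ∈ entry mv sc r c →
             proj₁ t ≡ + 1 × (∀ R C → ez (proj₂ t) R C ≡ zIndicator r c R C)
    tagged (just v) (inj₁ _) t∈ with ∈-*ₚ⁻ (zvar r c) (P v) t∈
    ... | _ , u , here refl , u∈ , refl with ∈-P-z-free v u∈
    ...   | u≡1 , u-z-free = cong (+ 1 ℤ.*_) u≡1 ,
            λ R C → trans (cong (zIndicator r c R C ℕ.+_) (u-z-free R C)) (ℕ.+-identityʳ _)
    tagged (just v) (inj₂ i) t∈ with does (m i ≟ v)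
    ... | true = proj₁ (∈-zvar*1⁻ t∈) , proj₂ (proj₂ (∈-zvar*1⁻ t∈))
    tagged nothing _ t∈ = proj₁ (∈-zvar*1⁻ t∈) , proj₂ (proj₂ (∈-zvar*1⁻ t∈))

  data EntryView (r c : Fin N) (μ : Mono k N) : Set where
    artificial : rowVertex r ≡ nothing → XYFree μ → EntryView r c μ
    personal   : ∀ {i} → rowVertex r ≡ just (m i) → splitAt ℓ c ≡ inj₂ i → XYFree μ → EntryView r c μ
    coloured   : ∀ {v j} → rowVertex r ≡ just v → splitAt ℓ c ≡ inj₁ j → Support v μ → EntryView r c μ

  entryView : ∀ {r c t} → t ∈ A r c → EntryView r c (proj₂ t)
  entryView {r} {c} t∈ with rowVertex r in row≡ | splitAt ℓ c in col≡
  ... | nothing | _ = artificial row≡ (proj₁ (proj₂ (∈-zvar*1⁻ t∈)))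
  ... | just v | inj₂ i with m i ≟ v
  ...   | yes refl = personal row≡ col≡ (proj₁ (proj₂ (∈-zvar*1⁻ t∈)))
  entryView {r} {c} t∈ | just v | inj₁ j with ∈-*ₚ⁻ (zvar r c) (P v) t∈
  ... | _ , u , here refl , u∈ , refl = coloured row≡ col≡ (record { Support (∈-P-support v u∈) })

  viewSet : ∀ {r c μ} → EntryView r c μ → Fin n → Bool
  viewSet (artificial _ _)   _ = false
  viewSet (personal _ _ _)   _ = false
  viewSet (coloured _ _ S)     = Support.set S

  viewSet-independent : ∀ {r c μ} (ν : EntryView r c μ) → Independent (viewSet ν)
  viewSet-independent (coloured _ _ S) = Support.independent S

  viewSet-x : ∀ {r c μ} (ν : EntryView r c μ) i → 1 ≤ ex μ i →
              viewSet ν (m i) ≡ true × ∃ λ j → splitAt ℓ c ≡ inj₁ j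
  viewSet-x (artificial _ xy-free)   i pos = ⊥-elim (ℕ.<⇒≢ pos (sym (proj₁ (xy-free i))))
  viewSet-x (personal _ _ xy-free)   i pos = ⊥-elim (ℕ.<⇒≢ pos (sym (proj₁ (xy-free i))))
  viewSet-x (coloured _ col≡ S)      i pos = Support.∋x S i pos , _ , col≡

  viewSet-y : ∀ {r c μ} (ν : EntryView r c μ) i → 1 ≤ ey μ i →
              DominatedBy (m i) (viewSet ν) × ∃₂ λ v j → rowVertex r ≡ just v × splitAt ℓ c ≡ inj₁ j
  viewSet-y (artificial _ xy-free)   i pos = ⊥-elim (ℕ.<⇒≢ pos (sym (proj₂ (xy-free i))))
  viewSet-y (personal _ _ xy-free)   i pos = ⊥-elim (ℕ.<⇒≢ pos (sym (proj₂ (xy-free i))))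
  viewSet-y (coloured row≡ col≡ S)   i pos = Support.dominated S i pos , _ , _ , row≡ , col≡

  OutsideClique : Set
  OutsideClique = ∀ u w → Outside m u → Outside m w → u ≢ w → Adj G u w

  splitAt-injective : ∀ {c c′ : Fin N} → splitAt ℓ c ≡ splitAt ℓ c′ → c ≡ c′
  splitAt-injective {c} {c′} eq =
    trans (sym (Fin.join-splitAt ℓ k c)) (trans (cong (Fin.join ℓ k) eq) (Fin.join-splitAt ℓ k c′))

  CoveringMonomial : Set
  CoveringMonomial = Σ (Mono k N) λ μ → coeff detA μ ≢ + 0 × (∀ i → 1 ≤ ex μ i × 1 ≤ ey μ i)

  module Rows (n≤N : n ≤ N) where

    rowOf : Fin n → Fin N
    rowOf u = inject≤ u n≤N

    rowOf-injective : Injective _≡_ _≡_ rowOf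
    rowOf-injective = Fin.inject≤-injective n≤N n≤N _ _

    rowVertex-rowOf : ∀ u → rowVertex (rowOf u) ≡ just u
    rowVertex-rowOf u with toℕ (rowOf u) <? n
    ... | yes p = cong just (Fin.toℕ-injective (trans (Fin.toℕ-fromℕ< p) (Fin.toℕ-inject≤ u n≤N)))
    ... | no ¬p = ⊥-elim (¬p (subst (ℕ._< n) (sym (Fin.toℕ-inject≤ u n≤N)) (Fin.toℕ<n u)))

    rowVertex≡just⇒ : ∀ {r v} → rowVertex r ≡ just v → r ≡ rowOf v
    rowVertex≡just⇒ {r} row≡ with toℕ r <? n
    rowVertex≡just⇒ {r} refl | yes p =
      Fin.toℕ-injective (sym (trans (Fin.toℕ-inject≤ (fromℕ< p) n≤N) (Fin.toℕ-fromℕ< p)))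

    IsVertexRow : Fin N → Set
    IsVertexRow r = T (is-just (rowVertex r))

    vertexAt : ∀ r → IsVertexRow r → Fin n
    vertexAt r = to-witness-T (rowVertex r)

    rowOf-vertexAt : ∀ r fr → rowOf (vertexAt r fr) ≡ r
    rowOf-vertexAt r fr with rowVertex r in row≡
    ... | just v = sym (rowVertex≡just⇒ row≡)

    vertexAt-rowOf : ∀ u fr → vertexAt (rowOf u) fr ≡ u
    vertexAt-rowOf u fr with rowVertex (rowOf u) in row≡
    ... | just v = just-injective (trans (sym row≡) (rowVertex-rowOf u))

    rowOf-isVertexRow : ∀ u → IsVertexRow (rowOf u)
    rowOf-isVertexRow u = subst (T ∘ is-just) (sym (rowVertex-rowOf u)) tt

    isVertexRow⇒< : ∀ r → IsVertexRow r → toℕ r < n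
    isVertexRow⇒< r fr with toℕ r <? n
    ... | yes p = p

    <⇒isVertexRow : ∀ r → toℕ r < n → IsVertexRow r
    <⇒isVertexRow r p with toℕ r <? n
    ... | yes _ = tt
    ... | no ¬p = ¬p p

    isVertexRow-downward : ∀ {r r′} → toℕ r ≤ toℕ r′ → IsVertexRow r′ → IsVertexRow r
    isVertexRow-downward {r} {r′} r≤r′ fr′ = <⇒isVertexRow r (ℕ.≤-<-trans r≤r′ (isVertexRow⇒< r′ fr′))

    artificialRow-full : ∀ r c → ¬ IsVertexRow r → ∃ λ t → t ∈ A r c
    artificialRow-full r c ¬fr with rowVertex r
    ... | just _  = ⊥-elim (¬fr tt)
    ... | nothing = _ , ∈-zvar*⁺ {u = + 1 , mone} (here refl)

  module Forward (n≤N : n ≤ N) (m-injective : Injective _≡_ _≡_ m) (clique : OutsideClique)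
                 (dc : DominatorColoring G ℓ) where
    open Rows n≤N
    open DominatorColoring dc renaming (col to κ)

    -- A colour class inside M is given its colour column by its member of least index.
    Leader : Fin k → Set
    Leader i = (∀ w → κ w ≡ κ (m i) → ∃ λ i′ → m i′ ≡ w) × (∀ i′ → κ (m i′) ≡ κ (m i) → i Fin.≤ i′)

    leader? : ∀ i → Dec (Leader i)
    leader? i = Fin.all? (λ w → (κ w ≟ κ (m i)) →-dec Fin.any? (λ i′ → m i′ ≟ w))
          ×-dec Fin.all? (λ i′ → (κ (m i′) ≟ κ (m i)) →-dec (i Fin.≤? i′))

    data Role (u : Fin n) : Set where
      outside  : Outside m u → Role u
      leader   : ∀ {i} → m i ≡ u → Leader i → Role u
      follower : ∀ {i} → m i ≡ u → ¬ Leader i → Role u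

    role : ∀ u → Role u
    role u with Fin.any? (λ i → m i ≟ u)
    ... | no ∉m = outside (λ i mi≡u → ∉m (i , mi≡u))
    ... | yes (i , mi≡u) with leader? i
    ...   | yes lead = leader mi≡u lead
    ...   | no ¬lead = follower mi≡u ¬lead

    column : ∀ {u} → Role u → Fin N
    column {u} (outside _)    = κ u ↑ˡ k
    column {u} (leader _ _)   = κ u ↑ˡ k
    column (follower {i} _ _) = ℓ ↑ʳ i

    column-injective : ∀ {u w} (ρ : Role u) (σ : Role w) → column ρ ≡ column σ → u ≡ w
    column-injective {u} {w} (outside out) (outside out′) eq with u ≟ w
    ... | yes u≡w = u≡w
    ... | no u≢w  = ⊥-elim (proper u w (clique u w out out′ u≢w) (Fin.↑ˡ-injective k _ _ eq))
    column-injective (outside out) (leader refl (class⊆M , _)) eq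
      with class⊆M _ (Fin.↑ˡ-injective k _ _ eq)
    ... | i , mi≡u = ⊥-elim (out i mi≡u)
    column-injective (leader refl (class⊆M , _)) (outside out) eq
      with class⊆M _ (Fin.↑ˡ-injective k _ _ (sym eq))
    ... | i , mi≡w = ⊥-elim (out i mi≡w)
    column-injective (leader {i} refl (_ , least-i)) (leader {i′} refl (_ , least-i′)) eq =
      cong m (Fin.≤-antisym (least-i i′ (sym same)) (least-i′ i same))
      where
      same : κ (m i) ≡ κ (m i′)
      same = Fin.↑ˡ-injective k _ _ eq
    column-injective (follower {i} refl _) (follower {i′} refl _) eq = cong m (Fin.↑ʳ-injective ℓ i i′ eq)
    column-injective (outside _)    (follower _ _) eq = ⊥-elim (↑ˡ≢↑ʳ _ _ eq)
    column-injective (leader _ _)   (follower _ _) eq = ⊥-elim (↑ˡ≢↑ʳ _ _ eq)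
    column-injective (follower _ _) (outside _)    eq = ⊥-elim (↑ˡ≢↑ʳ _ _ (sym eq))
    column-injective (follower _ _) (leader _ _)   eq = ⊥-elim (↑ˡ≢↑ʳ _ _ (sym eq))

    classM : Fin n → Vec Bool k
    classM u = tabulate λ i → does (κ (m i) ≟ κ u)

    classM-colour : ∀ u i → lookup (classM u) i ≡ true → κ (m i) ≡ κ u
    classM-colour u i eq = does-true⇒ (κ (m i) ≟ κ u) (trans (sym (lookup∘tabulate _ i)) eq)

    classM-∋ : ∀ u i → κ (m i) ≡ κ u → lookup (classM u) i ≡ true
    classM-∋ u i eq = trans (lookup∘tabulate _ i) (dec-true (κ (m i) ≟ κ u) eq)

    supportSet : ∀ {u} → Role u → Fin n → Bool
    supportSet {u} (outside _) = withVertex (classM u) u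
    supportSet {u} _           = memS (classM u)

    memS-classM-colour : ∀ u w → memS (classM u) w ≡ true → κ w ≡ κ u
    memS-classM-colour u w w∈ with memS-true⁻ (classM u) w w∈
    ... | i , Sᵢ , refl = classM-colour u i Sᵢ

    supportSet-colour : ∀ {u} (ρ : Role u) w → supportSet ρ w ≡ true → κ w ≡ κ u
    supportSet-colour {u} (outside _) w w∈ with ∨-true⁻ w∈
    ... | inj₁ w∈S  = memS-classM-colour u w w∈S
    ... | inj₂ w≟u  = cong κ (does-true⇒ (w ≟ u) w≟u)
    supportSet-colour {u} (leader _ _)   w w∈ = memS-classM-colour u w w∈
    supportSet-colour {u} (follower _ _) w w∈ = memS-classM-colour u w w∈

    supportSet-independent : ∀ {u} (ρ : Role u) → independentB (supportSet ρ) ≡ true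
    supportSet-independent ρ = independentB-true⁺ _ λ a b a∈ b∈ a~b →
      proper a b a~b (trans (supportSet-colour ρ a a∈) (sym (supportSet-colour ρ b b∈)))

    choiceFor : ∀ {u} → Role u → Term k N
    choiceFor {u} ρ@(follower _ _) = zTerm (rowOf u) (column ρ) *ₜ (+ 1 , mone)
    choiceFor {u} ρ                = zTerm (rowOf u) (column ρ) *ₜ (+ 1 , termMono (classM u) (supportSet ρ))

    choiceFor∈ : ∀ {u} (ρ : Role u) → choiceFor ρ ∈ A (rowOf u) (column ρ)
    choiceFor∈ {u} ρ@(outside out)
      rewrite rowVertex-rowOf u | Fin.splitAt-↑ˡ ℓ (κ u) k | inM-false out =
      ∈-zvar*⁺ (∈-P₁⁺ (classM u) u (supportSet-independent ρ))
    choiceFor∈ {u} ρ@(leader {i} mi≡u _)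
      rewrite rowVertex-rowOf u | Fin.splitAt-↑ˡ ℓ (κ u) k | inM-true⁺ mi≡u =
      ∈-zvar*⁺ (∈-P₂⁺ (classM u) u (supportSet-independent ρ)
          (subst (λ w → memS (classM u) w ≡ true) mi≡u
            (memS-true⁺ (classM u) i (classM-∋ u i (cong κ mi≡u)))))
    choiceFor∈ {u} ρ@(follower {i} mi≡u _)
      rewrite rowVertex-rowOf u | Fin.splitAt-↑ʳ ℓ k i | dec-true (m i ≟ u) mi≡u =
      ∈-zvar*⁺ {u = + 1 , mone} (here refl)

    vertexRows : PartialTransversal A (is-just ∘ rowVertex)
    vertexRows = record
      { column           = λ r fr → column (role (vertexAt r fr))
      ; column-injective = λ {r} {r′} fr fr′ eq → trans (sym (rowOf-vertexAt r fr))
          (trans (cong rowOf (column-injective (role (vertexAt r fr)) (role (vertexAt r′ fr′)) eq))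
                 (rowOf-vertexAt r′ fr′))
      ; choice           = λ r fr → choiceFor (role (vertexAt r fr))
      ; choice∈          = λ r fr →
          subst (λ r′ → choiceFor (role (vertexAt r fr)) ∈ A r′ (column (role (vertexAt r fr))))
          (rowOf-vertexAt r fr) (choiceFor∈ (role (vertexAt r fr)))
      }

    class⊆M : ∀ x → ¬ (∃ λ q → Outside m q × κ q ≡ κ x) → ∀ w → κ w ≡ κ x → ∃ λ i → m i ≡ w
    class⊆M x no-outside w κw≡κx with Fin.any? (λ i → m i ≟ w)
    ... | yes w∈M = w∈M
    ... | no ∉m   = ⊥-elim (no-outside (w , (λ i mi≡w → ∉m (i , mi≡w)) , κw≡κx))

    representative : ∀ x → ∃ λ o → κ o ≡ κ x × (∀ (ρ : Role o) → column ρ ≡ κ o ↑ˡ k)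
    representative x with Fin.any? (λ q → Fin.all? (λ i → ¬? (m i ≟ q)) ×-dec (κ q ≟ κ x))
    ... | yes (q , out , κq≡κx) = q , κq≡κx , λ
      { (outside _)       → refl
      ; (leader mi≡q _)   → ⊥-elim (out _ mi≡q)
      ; (follower mi≡q _) → ⊥-elim (out _ mi≡q)
      }
    ... | no no-outside
      with least (λ i → κ (m i) ≟ κ x) (let i , mi≡x = class⊆M x no-outside x refl in i , cong κ mi≡x)
    ...   | i₀ , κi₀≡κx , minimal = m i₀ , κi₀≡κx , λ
      { (outside out)           → ⊥-elim (out i₀ refl)
      ; (leader _ _)            → refl
      ; (follower mi≡mi₀ ¬lead) → ⊥-elim (¬lead (subst Leader (sym (m-injective mi≡mi₀)) lead))
      }
      where
      lead : Leader i₀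
      lead = (λ w κw≡ → class⊆M x no-outside w (trans κw≡ κi₀≡κx)) ,
             (λ i′ eq → minimal i′ (trans eq κi₀≡κx))

    choiceFor-x : ∀ {o} (ρ : Role o) → column ρ ≡ κ o ↑ˡ k → ∀ i → κ (m i) ≡ κ o →
                  1 ≤ ex (proj₂ (choiceFor ρ)) i
    choiceFor-x {o} (outside _)    _     i eq = if-true (classM-∋ o i eq)
    choiceFor-x {o} (leader _ _)   _     i eq = if-true (classM-∋ o i eq)
    choiceFor-x     (follower _ _) col≡  _ _  = ⊥-elim (↑ˡ≢↑ʳ _ _ (sym col≡))

    choiceFor-y : ∀ {o} (ρ : Role o) → column ρ ≡ κ o ↑ˡ k → ∀ i →
                  (∀ w → κ w ≡ κ o → InClosedNbhd G (m i) w) → 1 ≤ ey (proj₂ (choiceFor ρ)) i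
    choiceFor-y ρ@(outside _)  _ i dom =
      if-true (dominatorsB-true⁺ _ i λ w w∈ → dom w (supportSet-colour ρ w w∈))
    choiceFor-y ρ@(leader _ _) _ i dom =
      if-true (dominatorsB-true⁺ _ i λ w w∈ → dom w (supportSet-colour ρ w w∈))
    choiceFor-y (follower _ _) col≡ _ _ = ⊥-elim (↑ˡ≢↑ʳ _ _ (sym col≡))

    monomial : CoveringMonomial
    monomial with ∈-det⁺ N A isVertexRow-downward artificialRow-full vertexRows
    ... | t , t∈ , below = proj₂ t , coeff-det≢0 A-tagged (λ eq → eq) (λ eq → eq) t∈ ,
                           λ i → x-covered i , y-covered i
      where
      via : ∀ f → IsAdditive f → ∀ o i → 1 ≤ f (proj₂ (choiceFor (role o))) i → 1 ≤ f (proj₂ t) i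
      via f f+ o i pos = ℕ.≤-trans
        (subst (λ v → 1 ≤ f (proj₂ (choiceFor (role v))) i)
          (sym (vertexAt-rowOf o (rowOf-isVertexRow o))) pos)
        (below f f+ (rowOf o) (rowOf-isVertexRow o) i)
      x-covered : ∀ i → 1 ≤ ex (proj₂ t) i
      x-covered i with representative (m i)
      ... | o , κo≡ , col≡ = via ex ex-additive o i (choiceFor-x (role o) (col≡ (role o)) i (sym κo≡))
      y-covered : ∀ i → 1 ≤ ey (proj₂ t) i
      y-covered i with dominates (m i)
      ... | j , (w , κw≡j) , dom with representative w
      ...   | o , κo≡κw , col≡ = via ey ey-additive o i
              (choiceFor-y (role o) (col≡ (role o)) i λ w′ eq → dom w′ (trans eq (trans κo≡κw κw≡j)))

  module Backward (n≤N : n ≤ N) (clique : OutsideClique) (k+k<n : k + k < n) (Tr : Transversal A)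
                  (x-covered : ∀ i → ∃ λ r → 1 ≤ ex (proj₂ (Transversal.choice Tr r)) i)
                  (y-covered : ∀ i → ∃ λ r → 1 ≤ ey (proj₂ (Transversal.choice Tr r)) i) where
    open Rows n≤N
    open Transversal Tr

    view : ∀ r → EntryView r (column r) (proj₂ (choice r))
    view r = entryView (choice∈ r)

    record Placement (u : Fin n) : Set where
      field
        row     : Fin N
        colour  : Fin ℓ
        column≡ : splitAt ℓ (column row) ≡ inj₁ colour
        ∈set    : viewSet (view row) u ≡ true

    home : ∀ u {c μ} (ν : EntryView (rowOf u) c μ) →
           (viewSet ν u ≡ true × ∃ λ j → splitAt ℓ c ≡ inj₁ j) ⊎ (∃ λ i → m i ≡ u × splitAt ℓ c ≡ inj₂ i)
    home u (artificial row≡ _) with trans (sym (rowVertex-rowOf u)) row≡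
    ... | ()
    home u (personal {i} row≡ col≡ _) =
      inj₂ (i , just-injective (trans (sym row≡) (rowVertex-rowOf u)) , col≡)
    home u (coloured row≡ col≡ S) =
      inj₁ (subst (λ v → Support.set S v ≡ true) (just-injective (trans (sym row≡) (rowVertex-rowOf u)))
              (Support.∋v S) ,
            _ , col≡)

    placement : ∀ u → Placement u
    placement u with home u (view (rowOf u))
    ... | inj₁ (∈set , j , col≡) = record { row = rowOf u ; colour = j ; column≡ = col≡ ; ∈set = ∈set }
    ... | inj₂ (i , refl , _) with x-covered i
    ...   | r , pos with viewSet-x (view r) i pos
    ...     | ∈set , j , col≡ = record { row = r ; colour = j ; column≡ = col≡ ; ∈set = ∈set }

    colour : Fin n → Fin ℓ
    colour u = Placement.colour (placement u)

    colour-row : ∀ {r r′ j} → splitAt ℓ (column r) ≡ inj₁ j → splitAt ℓ (column r′) ≡ inj₁ j → r ≡ r′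
    colour-row eq eq′ = column-injective (splitAt-injective (trans eq (sym eq′)))

    same-colour⇒same-row : ∀ u w → colour u ≡ colour w →
                           Placement.row (placement u) ≡ Placement.row (placement w)
    same-colour⇒same-row u w eq =
      colour-row (trans (Placement.column≡ (placement u)) (cong inj₁ eq)) (Placement.column≡ (placement w))

    colour-proper : ∀ u w → Adj G u w → colour u ≢ colour w
    colour-proper u w u~w eq = viewSet-independent (view r) u w (Placement.∈set (placement u))
      (subst (λ r′ → viewSet (view r′) w ≡ true) (sym (same-colour⇒same-row u w eq))
        (Placement.∈set (placement w)))
      u~w
      where
      r : Fin N
      r = Placement.row (placement u)

    placement-home : ∀ u {j} → splitAt ℓ (column (rowOf u)) ≡ inj₁ j → colour u ≡ j
    placement-home u col≡ with home u (view (rowOf u))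
    ... | inj₁ (_ , _ , col≡′) = inj₁-injective (trans (sym col≡′) col≡)
    ... | inj₂ (_ , _ , col≡′) with trans (sym col≡) col≡′
    ...   | ()

    outside-home : ∀ q → Outside m q → Placement.row (placement q) ≡ rowOf q
    outside-home q out with home q (view (rowOf q))
    ... | inj₁ _               = refl
    ... | inj₂ (i , mi≡q , _) = ⊥-elim (out i mi≡q)

    colour-injective-outside : ∀ {u w} → Outside m u → Outside m w → colour u ≡ colour w → u ≡ w
    colour-injective-outside {u} {w} out out′ eq = rowOf-injective
      (trans (sym (outside-home u out)) (trans (same-colour⇒same-row u w eq) (outside-home w out′)))

    DominatesClass : Fin n → Set
    DominatesClass x = Σ (Fin ℓ) λ j → (Σ (Fin n) λ w → colour w ≡ j) ×
                                       (∀ w → colour w ≡ j → InClosedNbhd G x w)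

    M-dominates : ∀ i → DominatesClass (m i)
    M-dominates i with y-covered i
    ... | r , pos with viewSet-y (view r) i pos
    ...   | dominated , v , j , row≡ , col≡ =
      j , (v , placement-home v (subst (λ r → splitAt ℓ (column r) ≡ inj₁ j) (rowVertex≡just⇒ row≡) col≡))
        ,
      λ w colour-w≡j → dominated w (subst (λ r → viewSet (view r) w ≡ true)
        (colour-row (trans (Placement.column≡ (placement w)) (cong inj₁ colour-w≡j)) col≡)
        (Placement.∈set (placement w)))

    outside-dominates : ∀ x → Outside m x → DominatesClass x
    outside-dominates x out with unused-colour m colour colour-injective-outside k+k<n
    ... | q , out-q , fresh = colour q , (q , refl) , nbhd
      where
      nbhd : ∀ w → colour w ≡ colour q → InClosedNbhd G x w
      nbhd w eq with Fin.any? (λ i → m i ≟ w)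
      ... | yes (i , refl) = ⊥-elim (fresh i eq)
      ... | no ∉m with colour-injective-outside (λ i mi≡w → ∉m (i , mi≡w)) out-q eq
      ...   | refl with x ≟ w
      ...     | yes refl = inj₁ refl
      ...     | no x≢w   = inj₂ (clique x w out out-q x≢w)

    colouring : DominatorColoring G ℓ
    colouring = record { col = colour ; proper = colour-proper ; dominates = dominates }
      where
      dominates : ∀ x → DominatesClass x
      dominates x with Fin.any? (λ i → m i ≟ x)
      ... | yes (i , refl) = M-dominates i
      ... | no ∉m          = outside-dominates x (λ i mi≡x → ∉m (i , mi≡x))

  colouring⇒monomial : n ≤ N → Injective _≡_ _≡_ m → OutsideClique →
                       DominatorColoring G ℓ → CoveringMonomial
  colouring⇒monomial = Forward.monomial

  monomial⇒colouring : n ≤ N → OutsideClique → k + k < n → CoveringMonomial → DominatorColoring G ℓ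
  monomial⇒colouring n≤N clique k+k<n (μ , coeff≢0 , covering) with coeff≢0⇒∃term detA μ coeff≢0
  ... | t , t∈ , match with ∈-det⁻ N A t∈
  ... | Tr , covered with does-true⇒ (proj₂ t ≟ₘ μ) match
  ... | ex≡ , ey≡ , _ = Backward.colouring n≤N clique k+k<n Tr
          (λ i → covered ex ex-additive i (subst (1 ≤_) (sym (ex≡ i)) (proj₁ (covering i))))
          (λ i → covered ey ey-additive i (subst (1 ≤_) (sym (ey≡ i)) (proj₂ (covering i))))

theorem6 : ∀ {n} (G : Graph n) (ℓ k : ℕ) (m : Fin k → Fin n) →
    Injective _≡_ _≡_ m →
    1 ≤ ℓ →
    (∀ u w → (∀ i → m i ≢ u) → (∀ i → m i ≢ w) → u ≢ w → Adj G u w) →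
    k < n ∸ k →
    n ≤ ℓ + k →
    DominatorColoring G ℓ ⇔
      Σ (Mono k (ℓ + k)) (λ mo →
        coeff (Construction.detA G ℓ k m) mo ≢ + 0 ×
        (∀ i → 1 ≤ ex mo i × 1 ≤ ey mo i))
theorem6 G ℓ k m m-injective _ clique k<n∸k n≤ℓ+k =
  mk⇔ (colouring⇒monomial n≤ℓ+k m-injective clique)
      (monomial⇒colouring n≤ℓ+k clique (k<n∸k⇒k+k<n k<n∸k))
  where open Reduction G ℓ k m
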